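{- $\mathbb{P}(L_3)$ does not satisfy transitivity: there exist $\Gamma,\Delta\subseteq For$ and $\alpha\in For$ such that $\Delta\vDash^{\mathbb{P}}_{L_3}\alpha$ and $\Gamma\vDash^{\mathbb{P}}_{L_3}\delta$ for all $\delta\in\Delta$, but $\Gamma\nvDash^{\mathbb{P}}_{L_3}\alpha$.
   Context: $For$ is the set of formulas built from a countable set $Prop$ of propositional letters with $\neg,\vee,\wedge,\rightarrow$. $L_3$ (Łukasiewicz) is given by the matrix with truth values $\{0,1/2,1\}$, designated set $\{1\}$, $f_\neg(x)=1-x$, $f_\vee=\max$, $f_\wedge=\min$, $f_\rightarrow(x,y)=\min\{1,1-x+y\}$; valuations are maps $Prop\to\{0,1/2,1\}$ extended via these functions. $\Gamma\vDash_{L_3}\alpha$ iff every valuation giving all members of $\Gamma$ value $1$ gives $\alpha$ value $1$; $\Gamma$ is $L_3$-consistent iff $\{\alpha:\Gamma\vDash_{L_3}\alpha\}\neq For$. $\Gamma\vDash^{\mathbb{P}}_{L_3}\alpha$ iff there exists an $L_3$-consistent $\Gamma'\subseteq\Gamma$ with $\Gamma'\vDash_{L_3}\alpha$. -}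

module Defs where

open import Data.Nat using (ℕ)
open import Data.Product using (Σ; ∃; _×_)
open import Relation.Binary.PropositionalEquality using (_≡_)
open import Relation.Nullary using (¬_)
open import Level using (0ℓ)
open import Relation.Unary using (Pred; _⊆_; _∈_)

Prop' : Set
Prop' = ℕ

data For : Set where
  var  : Prop' → For
  ~_   : For → For
  _∨_  : For → For → For
  _∧_  : For → For → For
  _⇒_  : For → For → For

-- Truth values {0, 1/2, 1}.
data V3 : Set where
  v0 vh v1 : V3

-- f¬(x) = 1 - x
f¬ : V3 → V3
f¬ v0 = v1
f¬ vh = vh
f¬ v1 = v0

-- f∨ = max
f∨ : V3 → V3 → V3
f∨ v0 y = y
f∨ vh v0 = vh
f∨ vh vh = vh
f∨ vh v1 = v1
f∨ v1 _ = v1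

-- f∧ = min
f∧ : V3 → V3 → V3
f∧ v0 _ = v0
f∧ vh v0 = v0
f∧ vh vh = vh
f∧ vh v1 = vh
f∧ v1 y = y

-- f→(x,y) = min{1, 1 - x + y}
f→ : V3 → V3 → V3
f→ v0 _  = v1
f→ vh v0 = vh
f→ vh vh = v1
f→ vh v1 = v1
f→ v1 y  = y

Valuation : Set
Valuation = Prop' → V3

⟦_⟧ : For → Valuation → V3
⟦ var p ⟧ v = v p
⟦ ~ a ⟧ v = f¬ (⟦ a ⟧ v)
⟦ a ∨ b ⟧ v = f∨ (⟦ a ⟧ v) (⟦ b ⟧ v)
⟦ a ∧ b ⟧ v = f∧ (⟦ a ⟧ v) (⟦ b ⟧ v)
⟦ a ⇒ b ⟧ v = f→ (⟦ a ⟧ v) (⟦ b ⟧ v)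

FSet : Set₁
FSet = Pred For 0ℓ

_⊨L3_ : FSet → For → Set
Γ ⊨L3 α = (v : Valuation) → ((γ : For) → γ ∈ Γ → ⟦ γ ⟧ v ≡ v1) → ⟦ α ⟧ v ≡ v1

Consistent : FSet → Set
Consistent Γ = ∃ λ β → ¬ (Γ ⊨L3 β)

_⊨P_ : FSet → For → Set₁
Γ ⊨P α = Σ FSet λ Γ' → (Γ' ⊆ Γ) × Consistent Γ' × (Γ' ⊨L3 α)

-- Take Γ = {p, ¬p} and Δ = {p ∨ q, ¬p}. Δ is satisfiable and yields q by disjunctive
-- syllogism, and each member of Δ follows from a satisfiable single member of Γ. But
-- p and ¬p are never both true, so every consistent part of Γ lies inside {p} or {¬p},
-- and neither of these yields q.
module Submission where

open import Defs
open import Data.Empty using (⊥-elim)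
open import Data.Nat using (zero; suc)
open import Data.Product using (Σ; _×_; _,_)
open import Data.Sum using (inj₁; inj₂; swap)
open import Function using (id)
open import Relation.Nullary using (¬_)
open import Relation.Unary using (_∈_; _∉_; _⊆_; ｛_｝; _∪_)
open import Relation.Binary.PropositionalEquality using (_≡_; _≢_; refl)

Satisfies : Valuation → FSet → Set
Satisfies v Γ = (γ : For) → γ ∈ Γ → ⟦ γ ⟧ v ≡ v1

Satisfiable : FSet → Set
Satisfiable Γ = Σ Valuation λ v → Satisfies v Γ

satisfies-｛｝ : ∀ {v α} → ⟦ α ⟧ v ≡ v1 → Satisfies v ｛ α ｝
satisfies-｛｝ α-true _ refl = α-true

satisfies-∪ : ∀ {v Γ Δ} → Satisfies v Γ → Satisfies v Δ → Satisfies v (Γ ∪ Δ)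
satisfies-∪ sat-Γ sat-Δ γ (inj₁ γ∈Γ) = sat-Γ γ γ∈Γ
satisfies-∪ sat-Γ sat-Δ γ (inj₂ γ∈Δ) = sat-Δ γ γ∈Δ

⊨L3-mono : ∀ {Γ Γ' α} → Γ' ⊆ Γ → Γ' ⊨L3 α → Γ ⊨L3 α
⊨L3-mono sub ent v sat = ent v (λ γ γ∈Γ' → sat γ (sub γ∈Γ'))

countermodel : ∀ {Γ} α v → Satisfies v Γ → ⟦ α ⟧ v ≢ v1 → ¬ (Γ ⊨L3 α)
countermodel α v sat α-untrue ent = α-untrue (ent v sat)

contradiction-untrue : ∀ α v → ⟦ α ∧ (~ α) ⟧ v ≢ v1
contradiction-untrue α v with ⟦ α ⟧ v
... | v0 = λ ()
... | vh = λ ()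
... | v1 = λ ()

satisfiable⇒consistent : ∀ {Γ} → Satisfiable Γ → Consistent Γ
satisfiable⇒consistent (v , sat) =
  var 0 ∧ (~ var 0) , countermodel (var 0 ∧ (~ var 0)) v sat (contradiction-untrue (var 0) v)

explosion : ∀ {Γ} α β → α ∈ Γ → ~ α ∈ Γ → Γ ⊨L3 β
explosion α β α∈Γ ~α∈Γ v sat with ⟦ α ⟧ v | sat α α∈Γ | sat (~ α) ~α∈Γ
... | v1 | _ | ()

contradictory⇒inconsistent : ∀ {Γ} α → α ∈ Γ → ~ α ∈ Γ → ¬ Consistent Γ
contradictory⇒inconsistent α α∈Γ ~α∈Γ (β , ¬Γ⊨β) = ¬Γ⊨β (explosion α β α∈Γ ~α∈Γ)

∨-introˡ : ∀ {Γ} α β → α ∈ Γ → Γ ⊨L3 (α ∨ β)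
∨-introˡ α β α∈Γ v sat with ⟦ α ⟧ v | sat α α∈Γ
... | v1 | refl = refl

disjunctive-syllogism : ∀ {Γ} α β → (α ∨ β) ∈ Γ → ~ α ∈ Γ → Γ ⊨L3 β
disjunctive-syllogism α β α∨β∈Γ ~α∈Γ v sat with ⟦ α ⟧ v | sat (α ∨ β) α∨β∈Γ | sat (~ α) ~α∈Γ
... | v0 | β-true | _ = β-true
... | vh | _      | ()
... | v1 | _      | ()

⊨P-intro : ∀ {Γ} Γ' α → Γ' ⊆ Γ → Satisfiable Γ' → Γ' ⊨L3 α → Γ ⊨P α
⊨P-intro Γ' α sub sat ent = Γ' , sub , satisfiable⇒consistent sat , ent

⊆-∪-drop : ∀ {Γ' : FSet} {α β} → Γ' ⊆ ｛ α ｝ ∪ ｛ β ｝ → α ∉ Γ' → Γ' ⊆ ｛ β ｝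
⊆-∪-drop sub α∉Γ' γ∈Γ' with sub γ∈Γ'
... | inj₁ refl = ⊥-elim (α∉Γ' γ∈Γ')
... | inj₂ γ≡β  = γ≡β

consistent-part-of-contradiction : ∀ {Γ'} α β → Γ' ⊆ ｛ α ｝ ∪ ｛ ~ α ｝ → Consistent Γ' →
  ¬ (｛ α ｝ ⊨L3 β) → ¬ (｛ ~ α ｝ ⊨L3 β) → ¬ (Γ' ⊨L3 β)
consistent-part-of-contradiction {Γ'} α β sub cons α⊭β ~α⊭β ent =
  ¬¬α∈Γ' λ α∈Γ' → ¬¬~α∈Γ' λ ~α∈Γ' → contradictory⇒inconsistent α α∈Γ' ~α∈Γ' cons
  where
  ¬¬α∈Γ' : ¬ ¬ (α ∈ Γ')
  ¬¬α∈Γ' α∉Γ' = ~α⊭β (⊨L3-mono {α = β} (⊆-∪-drop sub α∉Γ') ent)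
  ¬¬~α∈Γ' : ¬ ¬ (~ α ∈ Γ')
  ¬¬~α∈Γ' ~α∉Γ' = α⊭β (⊨L3-mono {α = β} (⊆-∪-drop (λ m → swap (sub m)) ~α∉Γ') ent)

p q : For
p = var 0
q = var 1

only-p-true only-q-true all-false : Valuation
only-p-true zero    = v1
only-p-true (suc _) = v0
only-q-true zero    = v0
only-q-true (suc _) = v1
all-false _ = v0

proposition8 : Σ FSet λ Γ → Σ FSet λ Δ → Σ For λ α →
    (Δ ⊨P α) × ((δ : For) → δ ∈ Δ → Γ ⊨P δ) × ¬ (Γ ⊨P α)
proposition8 = Γ , Δ , q , Δ⊨Pq , Γ⊨PΔ , Γ⊭Pq
  where
  Γ Δ : FSet
  Γ = ｛ p ｝ ∪ ｛ ~ p ｝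
  Δ = ｛ p ∨ q ｝ ∪ ｛ ~ p ｝

  Δ⊨Pq : Δ ⊨P q
  Δ⊨Pq = ⊨P-intro Δ q id
    (only-q-true , satisfies-∪ (satisfies-｛｝ refl) (satisfies-｛｝ refl))
    (disjunctive-syllogism p q (inj₁ refl) (inj₂ refl))

  Γ⊨PΔ : (δ : For) → δ ∈ Δ → Γ ⊨P δ
  Γ⊨PΔ _ (inj₁ refl) = ⊨P-intro ｛ p ｝ (p ∨ q) inj₁ (only-p-true , satisfies-｛｝ refl) (∨-introˡ p q refl)
  Γ⊨PΔ _ (inj₂ refl) = ⊨P-intro ｛ ~ p ｝ (~ p) inj₂ (all-false , satisfies-｛｝ refl) (λ v sat → sat (~ p) refl)

  Γ⊭Pq : ¬ (Γ ⊨P q)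
  Γ⊭Pq (Γ' , Γ'⊆Γ , cons , Γ'⊨q) = consistent-part-of-contradiction p q Γ'⊆Γ cons
    (countermodel q only-p-true (satisfies-｛｝ refl) λ ())
    (countermodel q all-false (satisfies-｛｝ refl) λ ())
    Γ'⊨q
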